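{- The sparing number of the Grötzsch graph is $5$.
   Context: For $A,B\subseteq\mathbb{N}_0$, $A+B=\{a+b: a\in A, b\in B\}$. An integer additive set-indexer (IASI) of a graph $G$ is an injective $f:V(G)\to 2^{\mathbb{N}_0}$ such that $g_f(uv)=f(u)+f(v)$ is injective on $E(G)$. It is a weak IASI if $|g_f(uv)|=\max(|f(u)|,|f(v)|)$ for every edge $uv$. An edge is mono-indexed if its set-label has cardinality $1$. The sparing number $\varphi(G)$ is the minimum, over all weak IASIs of $G$, of the number of mono-indexed edges. The Grötzsch graph is the triangle-free graph with $11$ vertices and $20$ edges obtained as the Mycielskian of the $5$-cycle. -}

module Defs where

open import Data.Nat using (ℕ; _+_; _⊔_; _≤_)
open import Data.Nat.Properties using (_≟_)
open import Data.Fin using (Fin)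
open import Data.Fin using (#_)
open import Data.List using (List; length; map; concatMap; deduplicate; filter; allFin)
open import Data.List.Membership.Propositional using (_∈_)
open import Data.Vec using (Vec; []; _∷_; lookup)
open import Data.Product using (_×_; _,_; proj₁; proj₂; Σ)
open import Function.Bundles using (_⇔_)
open import Relation.Binary.PropositionalEquality using (_≡_)

-- Finite subsets of ℕ₀, represented by (possibly unsorted, possibly
-- repetitive) lists; two lists denote the same set iff they have the same members.
FinSet : Set
FinSet = List ℕ

_≈ₛ_ : FinSet → FinSet → Set
A ≈ₛ B = ∀ x → (x ∈ A) ⇔ (x ∈ B)

card : FinSet → ℕ
card A = length (deduplicate _≟_ A)

_⊕_ : FinSet → FinSet → FinSet
A ⊕ B = concatMap (λ a → map (a +_) B) A

record Graph : Set where
  field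
    n m  : ℕ
    edge : Fin m → Fin n × Fin n
open Graph public

-- Grötzsch graph = Mycielskian of C₅.
-- Vertices: uᵢ = i (0..4, the 5-cycle), wᵢ = 5+i (shadow of uᵢ), z = 10.
-- Edges: uᵢu_{i+1} (5), wᵢu_{i-1}, wᵢu_{i+1} (10), wᵢz (5).
grotzschEdges : Vec (Fin 11 × Fin 11) 20
grotzschEdges =
  ((# 0) , (# 1)) ∷ ((# 1) , (# 2)) ∷ ((# 2) , (# 3)) ∷ ((# 3) , (# 4)) ∷ ((# 4) , (# 0)) ∷
  ((# 5) , (# 4)) ∷ ((# 5) , (# 1)) ∷ ((# 6) , (# 0)) ∷ ((# 6) , (# 2)) ∷ ((# 7) , (# 1)) ∷
  ((# 7) , (# 3)) ∷ ((# 8) , (# 2)) ∷ ((# 8) , (# 4)) ∷ ((# 9) , (# 3)) ∷ ((# 9) , (# 0)) ∷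
  ((# 5) , (# 10)) ∷ ((# 6) , (# 10)) ∷ ((# 7) , (# 10)) ∷ ((# 8) , (# 10)) ∷ ((# 9) , (# 10)) ∷ []

Grotzsch : Graph
Grotzsch = record { n = 11 ; m = 20 ; edge = lookup grotzschEdges }

module _ (G : Graph) where

  edgeLabel : (Fin (n G) → FinSet) → Fin (m G) → FinSet
  edgeLabel f e = f (proj₁ (edge G e)) ⊕ f (proj₂ (edge G e))

  IsIASI : (Fin (n G) → FinSet) → Set
  IsIASI f =
    (∀ u v → f u ≈ₛ f v → u ≡ v) ×
    (∀ e e′ → edgeLabel f e ≈ₛ edgeLabel f e′ → e ≡ e′)

  IsWeakIASI : (Fin (n G) → FinSet) → Set
  IsWeakIASI f = IsIASI f ×
    (∀ e → card (edgeLabel f e) ≡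
             card (f (proj₁ (edge G e))) ⊔ card (f (proj₂ (edge G e))))

  monoCount : (Fin (n G) → FinSet) → ℕ
  monoCount f = length (filter (λ e → card (edgeLabel f e) ≟ 1) (allFin (m G)))

  SparingNumberIs : ℕ → Set
  SparingNumberIs k =
    Σ (Fin (n G) → FinSet) (λ f → IsWeakIASI f × monoCount f ≡ k) ×
    (∀ f → IsWeakIASI f → k ≤ monoCount f)

-- In a weak IASI, an edge whose end labels both have at least two elements
-- is impossible: if b < b′ lie in B and A is nonempty, then A + B contains
-- the |A| sums A + b and, above them all, max A + b′.  Empty labels are
-- excluded as well: both ends would be empty, contradicting injectivity.
-- So the singleton-labelled vertices form a vertex cover, and every edge
-- with both ends in it is mono-indexed.  Every vertex cover of the
-- Grötzsch graph spans at least five edges (an exhaustive check over its 2¹¹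
-- vertex subsets), and five is attained by labelling the 5-cycle and the hub
-- with singletons and the shadow vertices with 2-sets.
module Submission where

open import Defs
open import Data.Nat using (ℕ; suc; _+_; _⊔_; _≡ᵇ_; _≤_; _<_; _≤?_; z≤n; s≤s)
open import Data.Nat.Properties
  using (_≟_; ≡ᵇ⇒≡; ≡⇒≡ᵇ; ≤-trans; <-irrefl; <-cmp; n<1+n; +-comm; +-mono-≤-<; +-cancelʳ-≡; ⊔-lub; ≤-antisym; module ≤-Reasoning)
open import Data.Fin using (Fin)
import Data.Fin.Properties as Fin
open import Data.Fin.Subset using (Subset) renaming (_∈_ to _∈ᵥ_)
open import Data.Fin.Subset.Properties using (anySubset?) renaming (_∈?_ to _∈ᵥ?_)
open import Data.List using (List; []; _∷_; length; map; filter; allFin; deduplicate)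
open import Data.List.Properties using (length-map)
open import Data.List.Extrema.Nat using (max; ⊥≤max; xs≤max; argmax-all)
open import Data.List.Membership.Propositional using (_∈_; find)
open import Data.List.Membership.Propositional.Properties
  using (∈-map⁺; ∈-map⁻; ∈-concatMap⁺; ∈-concatMap⁻; ∈-∃++; ∈-deduplicate⁺; ∈-deduplicate⁻)
open import Data.List.Relation.Binary.Subset.Propositional using (_⊆_)
open import Data.List.Relation.Binary.Subset.DecPropositional _≟_ using (_⊆?_)
open import Data.List.Relation.Binary.Permutation.Propositional.Properties using (shift; ↭-length; ∈-resp-↭)
import Data.List.Relation.Binary.Sublist.Propositional as Sublist
import Data.List.Relation.Binary.Sublist.Propositional.Properties as Sublist
open import Data.List.Relation.Unary.All as All using (All)
import Data.List.Relation.Unary.Any as Any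
open import Data.List.Relation.Unary.Any using (here; there)
open import Data.List.Relation.Unary.AllPairs using (_∷_)
open import Data.List.Relation.Unary.Unique.Propositional using (Unique)
import Data.List.Relation.Unary.Unique.Propositional.Properties as Unique
open import Data.List.Relation.Unary.Unique.DecPropositional.Properties _≟_ using (deduplicate-!)
open import Data.Vec using (lookup; tabulate) renaming ([] to []ᵥ; _∷_ to _∷ᵥ_)
open import Data.Vec.Properties using (lookup∘tabulate; lookup⇒[]=; []=⇒lookup)
open import Data.Product using (_×_; _,_; proj₁; proj₂; ∃; ∃₂)
open import Data.Sum as Sum using (_⊎_; inj₁; inj₂)
open import Data.Bool.Properties using (T-≡)
open import Data.Empty using (⊥-elim)
open import Function using (_∘_; id)
open import Function.Bundles using (mk⇔; Equivalence)
open import Relation.Binary using (tri<; tri≈; tri>)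
open import Relation.Binary.PropositionalEquality using (_≡_; _≢_; refl; sym; trans; cong; cong₂; subst)
open import Relation.Nullary using (¬_; Dec; yes; no; ¬?)
open import Relation.Nullary.Decidable using (_×-dec_; _⊎-dec_; _→-dec_; from-yes; from-no; decidable-stable)

Unique⇒length≤ : ∀ {xs ys : List ℕ} → Unique xs → xs ⊆ ys → length xs ≤ length ys
Unique⇒length≤ {[]} _ _ = z≤n
Unique⇒length≤ {x ∷ xs} (x∉xs ∷ xs!) x∷xs⊆ys
  with ys₁ , ys₂ , refl ← ∈-∃++ (x∷xs⊆ys (here refl)) =
  subst (suc (length xs) ≤_) (sym (↭-length (shift x ys₁ _))) (s≤s (Unique⇒length≤ xs! xs⊆ys₁ys₂))
  where
  xs⊆ys₁ys₂ : xs ⊆ _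
  xs⊆ys₁ys₂ z∈xs with ∈-resp-↭ (shift x ys₁ ys₂) (x∷xs⊆ys (there z∈xs))
  ... | here refl = ⊥-elim (All.lookup x∉xs z∈xs refl)
  ... | there z∈ys₁ys₂ = z∈ys₁ys₂

Unique⇒length≤card : ∀ {xs A} → Unique xs → xs ⊆ A → length xs ≤ card A
Unique⇒length≤card xs! xs⊆A = Unique⇒length≤ xs! (∈-deduplicate⁺ _≟_ ∘ xs⊆A)

card-mono : ∀ {A B} → A ⊆ B → card A ≤ card B
card-mono {A} A⊆B = Unique⇒length≤card (deduplicate-! A) (A⊆B ∘ ∈-deduplicate⁻ _≟_ A)

≈ₛ-empty : ∀ {A B} → card A ≡ 0 → card B ≡ 0 → A ≈ₛ B
≈ₛ-empty {[]} {[]} _ _ _ = mk⇔ id id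

2≤card⇒∃< : ∀ {B} → 2 ≤ card B → ∃₂ λ b b′ → b ∈ B × b′ ∈ B × b < b′
2≤card⇒∃< {B} 2≤|B| with deduplicate _≟_ B | deduplicate-! B | ∈-deduplicate⁻ _≟_ B
2≤card⇒∃< (s≤s (s≤s _)) | x ∷ y ∷ _ | (x∉ ∷ _) | ∈B with <-cmp x y
... | tri< x<y _ _ = x , y , ∈B (here refl) , ∈B (there (here refl)) , x<y
... | tri≈ _ x≡y _ = ⊥-elim (All.lookup x∉ (here refl) x≡y)
... | tri> _ _ y<x = y , x , ∈B (there (here refl)) , ∈B (here refl) , y<x

∈-⊕⁺ : ∀ {a b A B} → a ∈ A → b ∈ B → a + b ∈ A ⊕ B
∈-⊕⁺ a∈A b∈B = ∈-concatMap⁺ _ (Any.map (λ { refl → ∈-map⁺ _ b∈B }) a∈A)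

∈-⊕⁻ : ∀ {z} A B → z ∈ A ⊕ B → ∃₂ λ a b → a ∈ A × b ∈ B × z ≡ a + b
∈-⊕⁻ A B z∈A⊕B
  with a , a∈A , z∈a+B ← find (∈-concatMap⁻ _ {A} z∈A⊕B)
  with b , b∈B , refl ← ∈-map⁻ _ z∈a+B = a , b , a∈A , b∈B , refl

⊕-comm-⊆ : ∀ A B → A ⊕ B ⊆ B ⊕ A
⊕-comm-⊆ A B z∈A⊕B with a , b , a∈A , b∈B , refl ← ∈-⊕⁻ A B z∈A⊕B =
  subst (_∈ B ⊕ A) (+-comm b a) (∈-⊕⁺ b∈B a∈A)

card-⊕-comm : ∀ A B → card (A ⊕ B) ≡ card (B ⊕ A)
card-⊕-comm A B = ≤-antisym (card-mono (⊕-comm-⊆ A B)) (card-mono (⊕-comm-⊆ B A))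

⊕-zeroʳ : ∀ A → A ⊕ [] ≡ []
⊕-zeroʳ [] = refl
⊕-zeroʳ (_ ∷ A) = ⊕-zeroʳ A

card-⊕-zeroˡ : ∀ A B → card A ≡ 0 → card (A ⊕ B) ≡ 0
card-⊕-zeroˡ [] _ _ = refl

card-⊕-zeroʳ : ∀ A B → card B ≡ 0 → card (A ⊕ B) ≡ 0
card-⊕-zeroʳ A [] _ = cong card (⊕-zeroʳ A)

card<card-⊕ : ∀ A B → 1 ≤ card A → 2 ≤ card B → card A < card (A ⊕ B)
card<card-⊕ A@(a ∷ A′) B _ 2≤|B| with b , b′ , b∈B , b′∈B , b<b′ ← 2≤card⇒∃< 2≤|B| = begin-strict
  card A                           ≡⟨ length-map (_+ b) D ⟨
  length (map (_+ b) D)            <⟨ n<1+n _ ⟩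
  length (top ∷ map (_+ b) D)      ≤⟨ Unique⇒length≤card sums! sums⊆A⊕B ⟩
  card (A ⊕ B)                     ∎
  where
  open ≤-Reasoning
  D : List ℕ
  D = deduplicate _≟_ A
  top : ℕ
  top = max a A′ + b′
  ≤max : ∀ {x} → x ∈ A → x ≤ max a A′
  ≤max (here refl) = ⊥≤max a A′
  ≤max (there x∈A′) = All.lookup (xs≤max a A′) x∈A′
  <top : ∀ {z} → z ∈ map (_+ b) D → z < top
  <top z∈ with x , x∈D , refl ← ∈-map⁻ _ z∈ = +-mono-≤-< (≤max (∈-deduplicate⁻ _≟_ A x∈D)) b<b′
  sums! : Unique (top ∷ map (_+ b) D)
  sums! = All.tabulate (λ z∈ top≡z → <-irrefl (sym top≡z) (<top z∈))
        ∷ Unique.map⁺ (+-cancelʳ-≡ b _ _) (deduplicate-! A)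
  sums⊆A⊕B : top ∷ map (_+ b) D ⊆ A ⊕ B
  sums⊆A⊕B (here refl) = ∈-⊕⁺ (argmax-all id {P = _∈ A} (here refl) (All.tabulate there)) b′∈B
  sums⊆A⊕B (there z∈) with x , x∈D , refl ← ∈-map⁻ _ z∈ = ∈-⊕⁺ (∈-deduplicate⁻ _≟_ A x∈D) b∈B

card⊔card<card-⊕ : ∀ A B → 2 ≤ card A → 2 ≤ card B → card A ⊔ card B < card (A ⊕ B)
card⊔card<card-⊕ A B 2≤|A| 2≤|B| = ⊔-lub
  (card<card-⊕ A B (≤-trans (s≤s z≤n) 2≤|A|) 2≤|B|)
  (subst (card B <_) (card-⊕-comm B A) (card<card-⊕ B A (≤-trans (s≤s z≤n) 2≤|B|) 2≤|A|))

card-⊕≡⊔⇒singleton : ∀ {A B} → ¬ (A ≈ₛ B) → card (A ⊕ B) ≡ card A ⊔ card B →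
                      card A ≡ 1 ⊎ card B ≡ 1
card-⊕≡⊔⇒singleton {A} {B} A≉B eq with card A in |A| | card B in |B|
... | 1 | _ = inj₁ refl
... | _ | 1 = inj₂ refl
... | 0 | _ = ⊥-elim (A≉B (≈ₛ-empty {A} {B} |A| (trans |B| (trans (sym eq) (card-⊕-zeroˡ A B |A|)))))
... | suc (suc _) | 0 = ⊥-elim (A≉B (≈ₛ-empty {A} {B} (trans |A| (trans (sym eq) (card-⊕-zeroʳ A B |B|))) |B|))
... | suc (suc _) | suc (suc _) = ⊥-elim (<-irrefl (sym eq)
  (subst (_< card (A ⊕ B)) (cong₂ _⊔_ |A| |B|) (card⊔card<card-⊕ A B (2≤card {A} |A|) (2≤card {B} |B|))))
  where
  2≤card : ∀ {X k} → card X ≡ suc (suc k) → 2 ≤ card X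
  2≤card |X| = subst (2 ≤_) (sym |X|) (s≤s (s≤s z≤n))

singletonVertices : ∀ {k} → (Fin k → FinSet) → Subset k
singletonVertices f = tabulate λ v → card (f v) ≡ᵇ 1

∈-singletonVertices⁺ : ∀ {k} (f : Fin k → FinSet) {v} → card (f v) ≡ 1 → v ∈ᵥ singletonVertices f
∈-singletonVertices⁺ f {v} |fv|≡1 =
  lookup⇒[]= v _ (trans (lookup∘tabulate _ v) (Equivalence.to T-≡ (≡⇒≡ᵇ (card (f v)) 1 |fv|≡1)))

∈-singletonVertices⁻ : ∀ {k} (f : Fin k → FinSet) {v} → v ∈ᵥ singletonVertices f → card (f v) ≡ 1
∈-singletonVertices⁻ f {v} v∈ =
  ≡ᵇ⇒≡ (card (f v)) 1 (Equivalence.from T-≡ (trans (sym (lookup∘tabulate _ v)) ([]=⇒lookup v∈)))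

module _ (G : Graph) where

  private
    end₁ end₂ : Fin (m G) → Fin (n G)
    end₁ e = proj₁ (edge G e)
    end₂ e = proj₂ (edge G e)

  Loopless : Set
  Loopless = ∀ e → end₁ e ≢ end₂ e

  IsVertexCover : Subset (n G) → Set
  IsVertexCover S = ∀ e → end₁ e ∈ᵥ S ⊎ end₂ e ∈ᵥ S

  isVertexCover? : ∀ S → Dec (IsVertexCover S)
  isVertexCover? S = Fin.all? λ e → (end₁ e ∈ᵥ? S) ⊎-dec (end₂ e ∈ᵥ? S)

  bothEndsIn? : ∀ S e → Dec (end₁ e ∈ᵥ S × end₂ e ∈ᵥ S)
  bothEndsIn? S e = (end₁ e ∈ᵥ? S) ×-dec (end₂ e ∈ᵥ? S)

  inducedEdgeCount : Subset (n G) → ℕ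
  inducedEdgeCount S = length (filter (bothEndsIn? S) (allFin (m G)))

  singletonVertices-cover : Loopless → ∀ f → IsWeakIASI G f → IsVertexCover (singletonVertices f)
  singletonVertices-cover loopless f ((f-injective , _) , weak) e =
    Sum.map (∈-singletonVertices⁺ f) (∈-singletonVertices⁺ f)
      (card-⊕≡⊔⇒singleton {f (end₁ e)} {f (end₂ e)} (loopless e ∘ f-injective _ _) (weak e))

  inducedEdgeCount-singletonVertices≤monoCount : ∀ f → IsWeakIASI G f →
    inducedEdgeCount (singletonVertices f) ≤ monoCount G f
  inducedEdgeCount-singletonVertices≤monoCount f (_ , weak) =
    Sublist.length-mono-≤ (Sublist.filter⁺ (bothEndsIn? (singletonVertices f)) (λ e → card (edgeLabel G f e) ≟ 1)
                                           mono-indexed (Sublist.⊆-refl {x = allFin (m G)}))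
    where
    mono-indexed : ∀ {e e′} → e ≡ e′ → end₁ e ∈ᵥ singletonVertices f × end₂ e ∈ᵥ singletonVertices f →
                   card (edgeLabel G f e′) ≡ 1
    mono-indexed {e} refl (u∈ , v∈) =
      trans (weak e) (cong₂ _⊔_ (∈-singletonVertices⁻ f u∈) (∈-singletonVertices⁻ f v∈))

  sparingNumber≥ : Loopless → ∀ {k} → (∀ S → IsVertexCover S → k ≤ inducedEdgeCount S) →
                   ∀ f → IsWeakIASI G f → k ≤ monoCount G f
  sparingNumber≥ loopless k≤ f f-weak = ≤-trans
    (k≤ _ (singletonVertices-cover loopless f f-weak))
    (inducedEdgeCount-singletonVertices≤monoCount f f-weak)

_≈ₛ?_ : ∀ A B → Dec (A ≈ₛ B)
A ≈ₛ? B with A ⊆? B | B ⊆? A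
... | yes A⊆B | yes B⊆A = yes λ _ → mk⇔ A⊆B B⊆A
... | no A⊈B  | _       = no λ A≈B → A⊈B (Equivalence.to (A≈B _))
... | _       | no B⊈A  = no λ A≈B → B⊈A (Equivalence.from (A≈B _))

injective? : ∀ {k} (f : Fin k → FinSet) → Dec (∀ u v → f u ≈ₛ f v → u ≡ v)
injective? f = Fin.all? λ u → Fin.all? λ v → (f u ≈ₛ? f v) →-dec (u Fin.≟ v)

isWeakIASI? : ∀ G f → Dec (IsWeakIASI G f)
isWeakIASI? G f = (injective? f ×-dec injective? (edgeLabel G f)) ×-dec Fin.all? λ e →
  card (edgeLabel G f e) ≟ card (f (proj₁ (edge G e))) ⊔ card (f (proj₂ (edge G e)))

grotzsch-loopless : Loopless Grotzsch
grotzsch-loopless = from-yes (Fin.all? λ e → ¬? (proj₁ (edge Grotzsch e) Fin.≟ proj₂ (edge Grotzsch e)))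

grotzsch-vertexCover⇒5≤inducedEdgeCount : ∀ S → IsVertexCover Grotzsch S → 5 ≤ inducedEdgeCount Grotzsch S
grotzsch-vertexCover⇒5≤inducedEdgeCount S S-cover =
  decidable-stable (5 ≤? _) λ 5≰ → no-sparse-cover (S , S-cover , 5≰)
  where
  no-sparse-cover : ¬ ∃ λ S → IsVertexCover Grotzsch S × ¬ (5 ≤ inducedEdgeCount Grotzsch S)
  no-sparse-cover = from-no (anySubset? λ S →
    isVertexCover? Grotzsch S ×-dec ¬? (5 ≤? inducedEdgeCount Grotzsch S))

grotzschLabelling : Fin 11 → FinSet
grotzschLabelling = lookup
  ((0 ∷ []) ∷ᵥ (1 ∷ []) ∷ᵥ (2 ∷ []) ∷ᵥ (4 ∷ []) ∷ᵥ (8 ∷ []) ∷ᵥ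
   (20 ∷ 21 ∷ []) ∷ᵥ (30 ∷ 31 ∷ []) ∷ᵥ (40 ∷ 41 ∷ []) ∷ᵥ (50 ∷ 51 ∷ []) ∷ᵥ (60 ∷ 61 ∷ []) ∷ᵥ
   (16 ∷ []) ∷ᵥ []ᵥ)

grotzschLabelling-weakIASI : IsWeakIASI Grotzsch grotzschLabelling
grotzschLabelling-weakIASI = from-yes (isWeakIASI? Grotzsch grotzschLabelling)

mainTheorem13 : SparingNumberIs Grotzsch 5
mainTheorem13 =
  (grotzschLabelling , grotzschLabelling-weakIASI , refl) ,
  sparingNumber≥ Grotzsch grotzsch-loopless grotzsch-vertexCover⇒5≤inducedEdgeCount
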